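{- Let $G=(V,E)$ be a directed graph with positive edge weights, $s\in V$, $T$ an $s$-arborescence, and $S\ni s$ the source side of a minimum $s$-cut with $|T\cap\partial^+(S)|=1$. Let $C_0,C_1,\dots$ and $P_1,P_2,\dots$ be the centroid sets and subtree collections produced by Stage I of the Centroid Algorithm (see context) on $T$. If $i\ge1$ and $C_j\subseteq S$ for every $0\le j<i$, then $\overline{S}$ is contained in exactly one subtree in $P_i$, and consequently at most one vertex $u\in C_i$ can be in $\overline{S}$.
   Context: An $s$-arborescence is a directed spanning tree rooted at $s$ with all edges directed away from $s$. $\overline S=V\setminus S$, $\partial^+(S)$ is the set of edges from $S$ to $\overline S$, and a minimum $s$-cut is $(S,\overline S)$ with $s\in S$, $\overline S\ne\emptyset$, minimizing the total weight of $\partial^+(S)$. For a tree on vertex set $U$, a centroid is a vertex whose removal leaves components each of at most $|U|/2$ vertices. Stage I of the Centroid Algorithm (treating $T$ as undirected): let $C_0=\{s\}$, let $P_1$ be the set of vertex sets of the components obtained by removing $s$ from $T$, and $i=1$. While $P_i\neq\emptyset$: $C_i$ consists of a chosen centroid $u$ of each subtree $U\in P_i$, and $P_{i+1}$ is the set of all components obtained by removing the chosen centroid from each $U\in P_i$; then increment $i$. -}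

module Defs where

open import Data.Nat using (ℕ; zero; suc; _+_; _*_; _≤_)
open import Data.Bool using (Bool; true; false; if_then_else_; _∧_; not)
open import Data.Fin using (Fin)
open import Data.Fin.Subset using (Subset; _∈_; _∉_; _⊆_; ⊤; _-_; ∣_∣; Nonempty; ∁)
open import Data.Vec using (lookup)
open import Data.List using (map; allFin)
open import Data.Nat.ListAction using (sum)
open import Data.Product using (Σ; ∃; _×_)
open import Data.Sum using (_⊎_)
open import Data.Empty using (⊥)
open import Function using (_∘_)
open import Relation.Nullary using (¬_)
open import Relation.Binary.PropositionalEquality using (_≡_; _≢_)

-- A graph with positive edge weights is a weight matrix w : Fin n → Fin n → ℕ;
-- (u , v) is an edge iff w u v > 0, and its weight is then w u v (positive).

Weights : ℕ → Set
Weights n = Fin n → Fin n → ℕ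

IsEdge : ∀ {n} → Weights n → Fin n → Fin n → Set
IsEdge w u v = 1 ≤ w u v

cutWeight : ∀ {n} → Weights n → Subset n → ℕ
cutWeight {n} w S =
  sum (map (λ u → sum (map (λ v →
    if lookup S u ∧ not (lookup S v) then w u v else 0) (allFin n))) (allFin n))

IsMinCut : ∀ {n} → Weights n → Fin n → Subset n → Set
IsMinCut w s S =
  s ∈ S × Nonempty (∁ S) ×
  (∀ S' → s ∈ S' → Nonempty (∁ S') → cutWeight w S ≤ cutWeight w S')

-- s-arborescences, encoded by a parent function par : the edges of T are
-- exactly (par v , v) for v ≢ s (par s is irrelevant).

iter : ∀ {n} → (Fin n → Fin n) → ℕ → Fin n → Fin n
iter f zero    x = x
iter f (suc k) x = f (iter f k x)

IsArborescence : ∀ {n} → Weights n → Fin n → (Fin n → Fin n) → Set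
IsArborescence w s par =
  (∀ v → v ≢ s → IsEdge w (par v) v) ×
  (∀ v → ∃ λ k → iter par k v ≡ s)          -- every vertex reached from s (acyclic, spanning)

OneTreeEdgeCrosses : ∀ {n} → Fin n → (Fin n → Fin n) → Subset n → Set
OneTreeEdgeCrosses s par S =
  ∃ λ v → (v ≢ s × par v ∈ S × v ∉ S) ×
          (∀ v' → v' ≢ s → par v' ∈ S → v' ∉ S → v' ≡ v)

module Tree {n : ℕ} (s : Fin n) (par : Fin n → Fin n) where

  Adj : Fin n → Fin n → Set
  Adj x y = (x ≢ s × par x ≡ y) ⊎ (y ≢ s × par y ≡ x)

  data ConnIn (W : Subset n) : Fin n → Fin n → Set where
    here : ∀ {x} → x ∈ W → ConnIn W x x
    step : ∀ {x y z} → x ∈ W → Adj x y → ConnIn W y z → ConnIn W x z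

  IsComponent : Subset n → Subset n → Set
  IsComponent W K =
    Nonempty K × (∀ x → x ∈ K → ∀ y → (y ∈ K → ConnIn W x y) × (ConnIn W x y → y ∈ K))

  IsCentroid : Subset n → Fin n → Set
  IsCentroid U c = c ∈ U × (∀ K → IsComponent (U - c) K → 2 * ∣ K ∣ ≤ ∣ U ∣)

  -- Stage I of the Centroid Algorithm. The choice of centroids is given
  -- by cen : cen i U is the centroid chosen for the subtree U ∈ P_i.
  -- P i U means U ∈ P_i ; InC i v means v ∈ C_i.

  module StageI (cen : ℕ → Subset n → Fin n) where

    P : ℕ → Subset n → Set
    P zero          U = ⊥
    P (suc zero)    K = IsComponent (⊤ - s) K
    P (suc (suc i)) K = ∃ λ U → P (suc i) U × IsComponent (U - cen (suc i) U) K

    InC : ℕ → Fin n → Set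
    InC zero    v = v ≡ s
    InC (suc i) v = ∃ λ U → P (suc i) U × cen (suc i) U ≡ v

    ValidChoice : Set
    ValidChoice = ∀ i U → P (suc i) U → IsCentroid U (cen (suc i) U)

{-# OPTIONS --safe #-}
-- Since T has exactly one edge leaving S and every vertex of the complement
-- reaches s along T, each vertex of the complement climbs inside the complement
-- to the head of that edge: the complement is connected in T. The subtrees of
-- each P_i are pairwise disjoint, and while no chosen centroid lies in the
-- complement, removing a centroid from the subtree containing it leaves the
-- complement inside one component. Every centroid of C_i lies in its own
-- subtree, so only the centroid of the subtree containing the complement can
-- lie in it.
module Submission where

open import Defs
open import Data.Nat using (ℕ; zero; suc; _≤_; _<_; _≤′_; ≤′-refl; ≤′-step)
open import Data.Nat.Properties using (≤-total; ≤⇒≤′; n<1+n; m<n⇒m<1+n)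
open import Data.Fin using (Fin; _≟_)
open import Data.Fin.Subset using (Subset; _∈_; _∉_; _⊆_; ∁; _-_; ⊤; Nonempty)
open import Data.Fin.Subset.Properties
  using (_∈?_; ∈⊤; x∈p∧x≢y⇒x∈p-y; p─q⊆p; ⊆-antisym; x∈∁p⇒x∉p; x∉p⇒x∈∁p)
open import Data.Vec using (tabulate)
open import Data.Vec.Properties using (lookup∘tabulate; lookup⇒[]=; []=⇒lookup)
open import Data.Bool using (true)
open import Data.Product using (∃; _×_; _,_; proj₁; proj₂)
open import Data.Sum using (_⊎_; inj₁; inj₂)
open import Data.Empty using (⊥-elim)
open import Function using (_∘_)
open import Relation.Unary using (Decidable)
open import Relation.Nullary using (Dec; yes; no; does; _×-dec_)
open import Relation.Nullary.Decidable using (dec-true)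
open import Relation.Binary.PropositionalEquality
  using (_≡_; _≢_; refl; sym; trans; cong; subst)

⟦_⟧ : ∀ {n} {P : Fin n → Set} → Decidable P → Subset n
⟦ P? ⟧ = tabulate (does ∘ P?)

does≡true⇒ : ∀ {A : Set} (a? : Dec A) → does a? ≡ true → A
does≡true⇒ (yes a) _ = a

module _ {n} {P : Fin n → Set} (P? : Decidable P) where

  ∈⟦⟧⁺ : ∀ {y} → P y → y ∈ ⟦ P? ⟧
  ∈⟦⟧⁺ {y} p = lookup⇒[]= y ⟦ P? ⟧ (trans (lookup∘tabulate _ y) (dec-true (P? y) p))

  ∈⟦⟧⁻ : ∀ {y} → y ∈ ⟦ P? ⟧ → P y
  ∈⟦⟧⁻ {y} y∈ = does≡true⇒ (P? y) (trans (sym (lookup∘tabulate _ y)) ([]=⇒lookup y∈))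

Fixed : ∀ {n} → (Fin n → Fin n) → Fin n → Set
Fixed f y = f y ≡ y

module _ {n} (f : Fin n → Fin n) where

  iter-comm : ∀ k x → iter f k (f x) ≡ f (iter f k x)
  iter-comm zero    x = refl
  iter-comm (suc k) x = cong f (iter-comm k x)

  iter-fixed-stable : ∀ x {a b} → a ≤ b → Fixed f (iter f a x) → iter f b x ≡ iter f a x
  iter-fixed-stable x {a} a≤b fixed = stable (≤⇒≤′ a≤b)
    where
    stable : ∀ {b} → a ≤′ b → iter f b x ≡ iter f a x
    stable ≤′-refl        = refl
    stable (≤′-step a≤′b) = trans (cong f (stable a≤′b)) fixed

  iter-fixed-unique : ∀ x a b → Fixed f (iter f a x) → Fixed f (iter f b x) →
                      iter f a x ≡ iter f b x
  iter-fixed-unique x a b fa fb with ≤-total a b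
  ... | inj₁ a≤b = sym (iter-fixed-stable x a≤b fa)
  ... | inj₂ b≤a = iter-fixed-stable x b≤a fb

  iter-agrees-until-fixed : ∀ (g : Fin n → Fin n) → (∀ y → Fixed f y ⊎ f y ≡ g y) →
                            ∀ k x → iter f k x ≡ iter g k x ⊎ Fixed f (iter f k x)
  iter-agrees-until-fixed g f≈g zero    x = inj₁ refl
  iter-agrees-until-fixed g f≈g (suc k) x with iter-agrees-until-fixed g f≈g k x
  ... | inj₂ fixed = inj₂ (cong f fixed)
  ... | inj₁ same with f≈g (iter f k x)
  ...   | inj₁ fixed = inj₂ (cong f fixed)
  ...   | inj₂ step  = inj₁ (trans step (cong g same))

module TreeConnectivity {n} (s : Fin n) (par : Fin n → Fin n) where
  open Tree s par

  Adj-sym : ∀ {x y} → Adj x y → Adj y x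
  Adj-sym (inj₁ e) = inj₂ e
  Adj-sym (inj₂ e) = inj₁ e

  ConnIn-source∈ : ∀ {W x y} → ConnIn W x y → x ∈ W
  ConnIn-source∈ (here x∈W)     = x∈W
  ConnIn-source∈ (step x∈W _ _) = x∈W

  ConnIn-target∈ : ∀ {W x y} → ConnIn W x y → y ∈ W
  ConnIn-target∈ (here y∈W)      = y∈W
  ConnIn-target∈ (step _ _ path) = ConnIn-target∈ path

  ConnIn-trans : ∀ {W x y z} → ConnIn W x y → ConnIn W y z → ConnIn W x z
  ConnIn-trans (here _)         q = q
  ConnIn-trans (step x∈W xy p) q = step x∈W xy (ConnIn-trans p q)

  ConnIn-sym : ∀ {W x y} → ConnIn W x y → ConnIn W y x
  ConnIn-sym (here x∈W)        = here x∈W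
  ConnIn-sym (step x∈W xy p) =
    ConnIn-trans (ConnIn-sym p) (step (ConnIn-source∈ p) (Adj-sym xy) (here x∈W))

  ConnIn-mono : ∀ {W W' x y} → W ⊆ W' → ConnIn W x y → ConnIn W' x y
  ConnIn-mono W⊆W' (here x∈W)      = here (W⊆W' x∈W)
  ConnIn-mono W⊆W' (step x∈W xy p) = step (W⊆W' x∈W) xy (ConnIn-mono W⊆W' p)

  Connected : Subset n → Set
  Connected X = ∀ {x y} → x ∈ X → y ∈ X → ConnIn X x y

  component⊆ : ∀ {W K} → IsComponent W K → K ⊆ W
  component⊆ (_ , closed) {y} y∈K = ConnIn-source∈ (proj₁ (closed y y∈K y) y∈K)

  component-unique : ∀ {W K K' z} → IsComponent W K → IsComponent W K' →
                     z ∈ K → z ∈ K' → K ≡ K'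
  component-unique {z = z} (_ , closed) (_ , closed') z∈K z∈K' =
    ⊆-antisym (λ {y} y∈K  → proj₂ (closed' z z∈K' y) (proj₁ (closed z z∈K y) y∈K))
              (λ {y} y∈K' → proj₂ (closed z z∈K y) (proj₁ (closed' z z∈K' y) y∈K'))

  -- Two vertices of W are connected in T[W] iff they have the same root,
  -- the last vertex reached by climbing towards s without leaving W.
  module Components (reach : ∀ v → ∃ λ k → iter par k v ≡ s) (W : Subset n) where

    climb : Fin n → Fin n
    climb y with y ≟ s | par y ∈? W
    ... | yes _ | _     = y
    ... | no _  | yes _ = par y
    ... | no _  | no _  = y

    climb-cases : ∀ y → Fixed climb y ⊎ (y ≢ s × par y ∈ W × climb y ≡ par y)
    climb-cases y with y ≟ s | par y ∈? W
    ... | yes _   | _         = inj₁ refl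
    ... | no y≢s  | yes py∈W  = inj₂ (y≢s , py∈W , refl)
    ... | no _    | no _      = inj₁ refl

    climb≈par : ∀ y → Fixed climb y ⊎ climb y ≡ par y
    climb≈par y with climb-cases y
    ... | inj₁ fixed          = inj₁ fixed
    ... | inj₂ (_ , _ , up)   = inj₂ up

    climb-s : Fixed climb s
    climb-s with s ≟ s
    ... | yes _   = refl
    ... | no s≢s = ⊥-elim (s≢s refl)

    climb-up : ∀ {y} → y ≢ s → par y ∈ W → climb y ≡ par y
    climb-up {y} y≢s py∈W with y ≟ s | par y ∈? W
    ... | yes y≡s | _        = ⊥-elim (y≢s y≡s)
    ... | no _    | yes _    = refl
    ... | no _    | no py∉W  = ⊥-elim (py∉W py∈W)

    climb-ConnIn : ∀ {y} → y ∈ W → ConnIn W y (climb y)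
    climb-ConnIn {y} y∈W with climb-cases y
    ... | inj₁ fixed = subst (ConnIn W y) (sym fixed) (here y∈W)
    ... | inj₂ (y≢s , py∈W , up) =
      subst (ConnIn W y) (sym up) (step y∈W (inj₁ (y≢s , refl)) (here py∈W))

    iter-climb-ConnIn : ∀ {y} k → y ∈ W → ConnIn W y (iter climb k y)
    iter-climb-ConnIn zero    y∈W = here y∈W
    iter-climb-ConnIn (suc k) y∈W =
      ConnIn-trans path (climb-ConnIn (ConnIn-target∈ path))
      where path = iter-climb-ConnIn k y∈W

    root : Fin n → Fin n
    root v = iter climb (proj₁ (reach v)) v

    root-fixed : ∀ v → Fixed climb (root v)
    root-fixed v with iter-agrees-until-fixed climb par climb≈par (proj₁ (reach v)) v
    ... | inj₁ same  = subst (Fixed climb) (sym (trans same (proj₂ (reach v)))) climb-s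
    ... | inj₂ fixed = fixed

    root-climb : ∀ v → root (climb v) ≡ root v
    root-climb v =
      trans (iter-comm climb k v)
            (iter-fixed-unique climb v (suc k) (proj₁ (reach v))
              (subst (Fixed climb) (iter-comm climb k v) (root-fixed (climb v)))
              (root-fixed v))
      where k = proj₁ (reach (climb v))

    ConnIn⇒root≡ : ∀ {x y} → ConnIn W x y → root x ≡ root y
    ConnIn⇒root≡ (here _) = refl
    ConnIn⇒root≡ {x} (step _ (inj₁ (x≢s , refl)) p) =
      trans (sym (root-climb x))
            (trans (cong root (climb-up x≢s (ConnIn-source∈ p))) (ConnIn⇒root≡ p))
    ConnIn⇒root≡ {x} (step {y = y} x∈W (inj₂ (y≢s , refl)) p) =
      trans (cong root (sym (climb-up y≢s x∈W))) (trans (root-climb y) (ConnIn⇒root≡ p))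

    root≡⇒ConnIn : ∀ {x y} → x ∈ W → y ∈ W → root x ≡ root y → ConnIn W x y
    root≡⇒ConnIn {x} {y} x∈W y∈W same =
      ConnIn-trans (iter-climb-ConnIn (proj₁ (reach x)) x∈W)
                   (subst (λ r → ConnIn W r y) (sym same)
                          (ConnIn-sym (iter-climb-ConnIn (proj₁ (reach y)) y∈W)))

    componentOf : Fin n → Subset n
    componentOf x = ⟦ (λ y → y ∈? W ×-dec root y ≟ root x) ⟧

    ∈componentOf⁻ : ∀ {x y} → y ∈ componentOf x → y ∈ W × root y ≡ root x
    ∈componentOf⁻ {x} = ∈⟦⟧⁻ (λ y → y ∈? W ×-dec root y ≟ root x)

    ∈componentOf⁺ : ∀ {x y} → y ∈ W → root y ≡ root x → y ∈ componentOf x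
    ∈componentOf⁺ {x} y∈W same = ∈⟦⟧⁺ (λ y → y ∈? W ×-dec root y ≟ root x) (y∈W , same)

    componentOf-isComponent : ∀ {x} → x ∈ W → IsComponent W (componentOf x)
    componentOf-isComponent {x} x∈W = (x , ∈componentOf⁺ x∈W refl) , closed
      where
      closed : ∀ a → a ∈ componentOf x → ∀ y →
               (y ∈ componentOf x → ConnIn W a y) × (ConnIn W a y → y ∈ componentOf x)
      closed a a∈ y with ∈componentOf⁻ a∈
      ... | a∈W , ra≡rx =
        (λ y∈ → let (y∈W , ry≡rx) = ∈componentOf⁻ y∈
                in root≡⇒ConnIn a∈W y∈W (trans ra≡rx (sym ry≡rx))) ,
        (λ path → ∈componentOf⁺ (ConnIn-target∈ path) (trans (sym (ConnIn⇒root≡ path)) ra≡rx))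

    component-containing : ∀ {X} → Connected X → X ⊆ W → Nonempty X →
                           ∃ λ K → IsComponent W K × X ⊆ K
    component-containing {X} X-conn X⊆W (x , x∈X) =
      componentOf x , componentOf-isComponent (X⊆W x∈X) , X⊆componentOf
      where
      X⊆componentOf : X ⊆ componentOf x
      X⊆componentOf y∈X = ∈componentOf⁺ (ConnIn-target∈ path) (sym (ConnIn⇒root≡ path))
        where path = ConnIn-mono X⊆W (X-conn x∈X y∈X)

  crossing-complement-connected : (∀ v → ∃ λ k → iter par k v ≡ s) →
    ∀ {S} → s ∈ S → OneTreeEdgeCrosses s par S → Connected (∁ S)
  crossing-complement-connected reach {S} s∈S (v₀ , _ , unique) y∈ y'∈ =
    ConnIn-trans (toHead y∈) (ConnIn-sym (toHead y'∈))
    where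
    ≢s : ∀ {y} → y ∈ ∁ S → y ≢ s
    ≢s y∈ refl = x∈∁p⇒x∉p y∈ s∈S

    climbs : ∀ k {y} → iter par k y ≡ s → y ∈ ∁ S → ConnIn (∁ S) y v₀
    climbs zero    reached y∈ = ⊥-elim (≢s y∈ reached)
    climbs (suc k) {y} reached y∈ with par y ∈? S
    ... | yes py∈S =
      subst (ConnIn (∁ S) y) (unique y (≢s y∈) py∈S (x∈∁p⇒x∉p y∈)) (here y∈)
    ... | no py∉S =
      step y∈ (inj₁ (≢s y∈ , refl))
           (climbs k (trans (iter-comm par k y) reached) (x∉p⇒x∈∁p py∉S))

    toHead : ∀ {y} → y ∈ ∁ S → ConnIn (∁ S) y v₀
    toHead {y} = climbs (proj₁ (reach y)) (proj₂ (reach y))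

⊆-minus : ∀ {n} {X U : Subset n} {c} → X ⊆ U → c ∉ X → X ⊆ U - c
⊆-minus X⊆U c∉X y∈X = x∈p∧x≢y⇒x∈p-y (X⊆U y∈X) λ { refl → c∉X y∈X }

module StageIProperties {n} (s : Fin n) (par : Fin n → Fin n)
                        (cen : ℕ → Subset n → Fin n) where
  open Tree s par
  open StageI cen
  open TreeConnectivity s par

  P-disjoint : ∀ i {U U' z} → P (suc i) U → P (suc i) U' → z ∈ U → z ∈ U' → U ≡ U'
  P-disjoint zero PU PU' z∈U z∈U' = component-unique PU PU' z∈U z∈U'
  P-disjoint (suc i) (V , PV , KU) (V' , PV' , KU') z∈U z∈U'
    with P-disjoint i PV PV' (p─q⊆p _ _ (component⊆ KU z∈U)) (p─q⊆p _ _ (component⊆ KU' z∈U'))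
  ... | refl = component-unique KU KU' z∈U z∈U'

  C-member-is-centroid-of : ValidChoice → ∀ i {u U} →
    InC (suc i) u → P (suc i) U → u ∈ U → u ≡ cen (suc i) U
  C-member-is-centroid-of valid i (V , PV , refl) PU u∈U =
    cong (cen (suc i)) (P-disjoint i PV PU (proj₁ (valid i V PV)) u∈U)

  P-contains-connected : (∀ v → ∃ λ k → iter par k v ≡ s) →
    ∀ i {X} → Connected X → Nonempty X →
    (∀ j → j < suc i → ∀ v → InC j v → v ∉ X) →
    ∃ λ U → P (suc i) U × X ⊆ U
  P-contains-connected reach zero X-conn X≠∅ avoids =
    Components.component-containing reach (⊤ - s) X-conn
      (⊆-minus (λ _ → ∈⊤) (avoids 0 (n<1+n 0) s refl)) X≠∅
  P-contains-connected reach (suc i) X-conn X≠∅ avoids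
    with P-contains-connected reach i X-conn X≠∅ (λ j j<i → avoids j (m<n⇒m<1+n j<i))
  ... | U , PU , X⊆U
    with Components.component-containing reach (U - cen (suc i) U) X-conn
           (⊆-minus X⊆U (avoids (suc i) (n<1+n (suc i)) _ (U , PU , refl))) X≠∅
  ... | K , K-comp , X⊆K = K , (U , PU , K-comp) , X⊆K

lemma2p8 : ∀ {n} (w : Weights n) (s : Fin n) (par : Fin n → Fin n) (S : Subset n)
    → IsArborescence w s par
    → IsMinCut w s S
    → OneTreeEdgeCrosses s par S
    → (cen : ℕ → Subset n → Fin n)
    → Tree.StageI.ValidChoice s par cen
    → (i : ℕ) → 1 ≤ i
    → (∀ j → j < i → ∀ v → Tree.StageI.InC s par cen j v → v ∈ S)
    → (∃ λ U → Tree.StageI.P s par cen i U × ∁ S ⊆ U ×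
         (∀ U' → Tree.StageI.P s par cen i U' → ∁ S ⊆ U' → U' ≡ U))
      × (∀ u u' → Tree.StageI.InC s par cen i u → Tree.StageI.InC s par cen i u'
           → u ∉ S → u' ∉ S → u ≡ u')
lemma2p8 w s par S (_ , reach) (s∈S , (x , x∈∁S) , _) crossing cen valid (suc i) _ C⊆S
  with StageIProperties.P-contains-connected s par cen reach i
         (TreeConnectivity.crossing-complement-connected s par reach s∈S crossing) (x , x∈∁S)
         (λ j j<i v Cv v∈∁S → x∈∁p⇒x∉p v∈∁S (C⊆S j j<i v Cv))
... | U , PU , ∁S⊆U =
  (U , PU , ∁S⊆U , λ U' PU' ∁S⊆U' → P-disjoint i PU' PU (∁S⊆U' x∈∁S) (∁S⊆U x∈∁S)) ,
  λ u u' Cu Cu' u∉S u'∉S → trans (centroid-of-U Cu u∉S) (sym (centroid-of-U Cu' u'∉S))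
  where
  open StageIProperties s par cen

  centroid-of-U : ∀ {u} → Tree.StageI.InC s par cen (suc i) u → u ∉ S → u ≡ cen (suc i) U
  centroid-of-U Cu u∉S = C-member-is-centroid-of valid i Cu PU (∁S⊆U (x∉p⇒x∈∁p u∉S))
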